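{- Let $a,b$ be even positive integers with $ab+1=r^2$ for a positive integer $r$ (so $r$ is odd). Define $a_+=\gcd(a/2,(r+1)/2)$, $a_-=\gcd(a/2,(r-1)/2)$, $b_+=\gcd(b/2,(r+1)/2)$, $b_-=\gcd(b/2,(r-1)/2)$. Then $a=2a_+a_-$, $b=2b_+b_-$, $r=a_+b_++a_-b_-$ and $a_+b_+-a_-b_-=1$. Moreover, setting $c=2(b_-+a_+)(b_++a_-)$, both $ac+1$ and $bc+1$ are perfect squares and $a^2+b^2+c^2-2ab-2ac-2bc-4=0$ (i.e. $\{a,b,c\}$ is a regular Diophantine triple).
   Context: A Diophantine triple is a set of distinct positive integers such that the product of any two is one less than a square; a triple $\{a,b,c\}$ is regular if $a^2+b^2+c^2-2ab-2ac-2bc-4=0$. -}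

module Defs where

open import Data.Nat using (ℕ; _+_; _*_; _∸_; _/_)
open import Data.Nat.GCD using (gcd)

plusPart : ℕ → ℕ → ℕ
plusPart x r = gcd (x / 2) ((r + 1) / 2)

minusPart : ℕ → ℕ → ℕ
minusPart x r = gcd (x / 2) ((r ∸ 1) / 2)

thirdElem : ℕ → ℕ → ℕ → ℕ
thirdElem a b r = 2 * ((minusPart b r + plusPart a r) * (plusPart b r + minusPart a r))

-- Writing a = 2x, b = 2y and r = 2k + 1, the hypothesis ab + 1 = r² becomes xy = k(k + 1).
-- Since k and k + 1 are coprime, every divisor d of k(k + 1) splits as gcd(d, k + 1)·gcd(d, k),
-- which gives x = a₊a₋ and y = b₊b₋. Then (a₊b₊)(a₋b₋) = (k + 1)k with k + 1 ∣ a₊b₊ and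
-- k ∣ a₋b₋ by coprimality, so a₊b₊ = k + 1 and a₋b₋ = k. Finally c = a + b + 2r, for which
-- ac + 1 = (a + r)², bc + 1 = (b + r)² and the regularity identity are polynomial identities.
module Submission where

open import Defs
open import Data.Nat using (ℕ; zero; suc; _+_; _*_; _<_; _/_; NonZero)
open import Data.Nat.Properties
  using (*-comm; *-identityˡ; *-cancelʳ-≡; suc-injective; m*n≡1⇒m≡1; m*n≡1⇒n≡1; m*n≢0; +-comm)
open import Data.Nat.Divisibility
  using (_∣_; divides; divides-refl; ∣-refl; ∣-trans; ∣-antisym; ∣1⇒≡1; ∣m+n∣m⇒∣n; m∣m*n; n∣m*n; ∣m⇒∣m*n)
open import Data.Nat.GCD using (gcd; gcd[m,n]∣m; gcd[m,n]∣n; gcd-greatest; c*gcd[m,n]≡gcd[cm,cn])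
open import Data.Nat.LCM using (lcm; lcm-least; gcd*lcm)
open import Data.Nat.Coprimality using (Coprime; coprime-divisor; coprime-+; 1-coprimeTo; coprime⇒gcd≡1)
  renaming (sym to sym-coprime)
open import Data.Nat.DivMod using (m*n/n≡m)
open import Data.Nat.Tactic.RingSolver using (solve-∀; solve)
open import Data.List using (_∷_; [])
open import Data.Product using (_×_; ∃; _,_)
open import Data.Sum using (_⊎_; inj₁; inj₂)
open import Relation.Nullary using (contradiction)
open import Relation.Binary.PropositionalEquality using (_≡_; refl; sym; trans; cong; cong₂; subst; module ≡-Reasoning)

private
  variable
    d m n o r s t : ℕ

coprime-∣ : Coprime m n → s ∣ m → t ∣ n → Coprime s t
coprime-∣ c s∣m t∣n (e∣s , e∣t) = c (∣-trans e∣s s∣m , ∣-trans e∣t t∣n)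

suc-coprime : ∀ k → Coprime (suc k) k
suc-coprime k = subst (λ n → Coprime n k) (+-comm k 1) (coprime-+ (1-coprimeTo k))

coprime-*-∣ : Coprime m n → m ∣ o → n ∣ o → m * n ∣ o
coprime-*-∣ {m} {n} c m∣o n∣o = subst (_∣ _) lcm≡m*n (lcm-least m∣o n∣o)
  where
  lcm≡m*n : lcm m n ≡ m * n
  lcm≡m*n = trans (sym (*-identityˡ (lcm m n)))
              (trans (cong (_* lcm m n) (sym (coprime⇒gcd≡1 c))) (gcd*lcm m n))

coprime-divisor₂ : Coprime d m → Coprime d n → d ∣ m * (n * o) → d ∣ o
coprime-divisor₂ cm cn d∣mno = coprime-divisor cn (coprime-divisor cm d∣mno)

∣*⇒∣*gcd : ∀ n → d ∣ n * m → d ∣ n * gcd d m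
∣*⇒∣*gcd {d} {m} n d∣nm =
  subst (d ∣_) (sym (c*gcd[m,n]≡gcd[cm,cn] n d m)) (gcd-greatest (n∣m*n n) d∣nm)

∣*⇒≡gcd*gcd : Coprime m n → d ∣ m * n → d ≡ gcd d m * gcd d n
∣*⇒≡gcd*gcd {m} {n} {d} c d∣mn = ∣-antisym d∣gcd*gcd gcd*gcd∣d
  where
  d∣gcd*gcd : d ∣ gcd d m * gcd d n
  d∣gcd*gcd = subst (d ∣_) (*-comm (gcd d n) (gcd d m))
    (∣*⇒∣*gcd (gcd d n) (subst (d ∣_) (*-comm m (gcd d n)) (∣*⇒∣*gcd m d∣mn)))
  gcd*gcd∣d : gcd d m * gcd d n ∣ d
  gcd*gcd∣d = coprime-*-∣ (coprime-∣ c (gcd[m,n]∣n d m) (gcd[m,n]∣n d n))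
                (gcd[m,n]∣m d m) (gcd[m,n]∣m d n)

∣-∣-*≡*⇒≡ : s ∣ m → t ∣ n → m * n ≡ s * t → .{{NonZero (s * t)}} → m ≡ s × n ≡ t
∣-∣-*≡*⇒≡ {s} {t = t} (divides-refl u) (divides-refl v) eq =
  trans (cong (_* s) (m*n≡1⇒m≡1 u v uv≡1)) (*-identityˡ s) ,
  trans (cong (_* t) (m*n≡1⇒n≡1 u v uv≡1)) (*-identityˡ t)
  where
  regroup : ∀ u v s t → u * v * (s * t) ≡ u * s * (v * t)
  regroup = solve-∀
  uv≡1 : u * v ≡ 1
  uv≡1 = *-cancelʳ-≡ (u * v) 1 (s * t) (trans (regroup u v s t) (trans eq (sym (*-identityˡ (s * t)))))

gcd-products-of-consecutive : ∀ x y k .{{_ : NonZero k}} → x * y ≡ suc k * k →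
  x ≡ gcd x (suc k) * gcd x k × y ≡ gcd y (suc k) * gcd y k
  × gcd x (suc k) * gcd y (suc k) ≡ suc k × gcd x k * gcd y k ≡ k
gcd-products-of-consecutive x y k xy≡ =
  x≡PM , y≡QN , ∣-∣-*≡*⇒≡ suc-k∣PQ k∣MN PQ*MN≡ {{m*n≢0 (suc k) k}}
  where
  P M Q N : ℕ
  P = gcd x (suc k)
  M = gcd x k
  Q = gcd y (suc k)
  N = gcd y k

  x≡PM : x ≡ P * M
  x≡PM = ∣*⇒≡gcd*gcd (suc-coprime k) (divides y (trans (sym xy≡) (*-comm x y)))

  y≡QN : y ≡ Q * N
  y≡QN = ∣*⇒≡gcd*gcd (suc-coprime k) (divides x (sym xy≡))

  PQ*MN≡ : P * Q * (M * N) ≡ suc k * k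
  PQ*MN≡ = begin
    P * Q * (M * N)  ≡⟨ regroup P Q M N ⟩
    P * M * (Q * N)  ≡⟨ cong₂ _*_ (sym x≡PM) (sym y≡QN) ⟩
    x * y            ≡⟨ xy≡ ⟩
    suc k * k        ∎
    where
    open ≡-Reasoning
    regroup : ∀ p q m n → p * q * (m * n) ≡ p * m * (q * n)
    regroup = solve-∀

  suc-k∣PQ : suc k ∣ P * Q
  suc-k∣PQ = coprime-divisor₂
    (coprime-∣ (suc-coprime k) ∣-refl (gcd[m,n]∣n x k))
    (coprime-∣ (suc-coprime k) ∣-refl (gcd[m,n]∣n y k))
    (subst (suc k ∣_) (trans (sym PQ*MN≡) (regroup P Q M N)) (m∣m*n k))
    where
    regroup : ∀ p q m n → p * q * (m * n) ≡ m * (n * (p * q))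
    regroup = solve-∀

  k∣MN : k ∣ M * N
  k∣MN = coprime-divisor₂
    (coprime-∣ (sym-coprime (suc-coprime k)) ∣-refl (gcd[m,n]∣n x (suc k)))
    (coprime-∣ (sym-coprime (suc-coprime k)) ∣-refl (gcd[m,n]∣n y (suc k)))
    (subst (k ∣_) (trans (sym PQ*MN≡) (regroup P Q M N)) (n∣m*n (suc k)))
    where
    regroup : ∀ p q m n → p * q * (m * n) ≡ p * (q * (m * n))
    regroup = solve-∀

even⊎odd : ∀ n → ∃ λ k → n ≡ k * 2 ⊎ n ≡ suc (k * 2)
even⊎odd zero = 0 , inj₁ refl
even⊎odd (suc n) with even⊎odd n
... | k , inj₁ refl = k , inj₂ refl
... | k , inj₂ refl = suc k , inj₁ refl

odd-square-root : 2 ∣ n → n + 1 ≡ r * r → ∃ λ k → r ≡ suc (k * 2)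
odd-square-root {n} {r} 2∣n n+1≡r² with even⊎odd r
... | k , inj₂ r≡ = k , r≡
... | k , inj₁ refl = contradiction (∣1⇒≡1 (∣m+n∣m⇒∣n 2∣n+1 2∣n)) λ ()
  where
  2∣n+1 : 2 ∣ n + 1
  2∣n+1 = subst (2 ∣_) (sym n+1≡r²) (∣m⇒∣m*n (k * 2) (n∣m*n k))

halves-product : ∀ x y k → x * 2 * (y * 2) + 1 ≡ suc (k * 2) * suc (k * 2) → x * y ≡ suc k * k
halves-product x y k eq = *-cancelʳ-≡ (x * y) (suc k * k) 4 (suc-injective (begin
  suc (x * y * 4)                ≡⟨ product-of-evens x y ⟩
  x * 2 * (y * 2) + 1            ≡⟨ eq ⟩
  suc (k * 2) * suc (k * 2)      ≡⟨ square-of-odd k ⟩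
  suc (suc k * k * 4)            ∎))
  where
  open ≡-Reasoning
  product-of-evens : ∀ x y → suc (x * y * 4) ≡ x * 2 * (y * 2) + 1
  product-of-evens = solve-∀
  square-of-odd : ∀ k → suc (k * 2) * suc (k * 2) ≡ suc (suc k * k * 4)
  square-of-odd = solve-∀

halves-product-nonZero : ∀ x y k → 0 < x * 2 → 0 < y * 2 → x * y ≡ suc k * k → NonZero k
halves-product-nonZero x y (suc k) _ _ _ = _
halves-product-nonZero (suc x) (suc y) zero _ _ ()

plusPart-double : ∀ x k → plusPart (x * 2) (suc (k * 2)) ≡ gcd x (suc k)
plusPart-double x k =
  cong₂ gcd (m*n/n≡m x 2) (trans (cong (_/ 2) (+-comm (suc (k * 2)) 1)) (m*n/n≡m (suc k) 2))

minusPart-double : ∀ x k → minusPart (x * 2) (suc (k * 2)) ≡ gcd x k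
minusPart-double x k = cong₂ gcd (m*n/n≡m x 2) (m*n/n≡m k 2)

ConjugateFactorisation : (a b r P M Q N : ℕ) → Set
ConjugateFactorisation a b r P M Q N =
  a ≡ 2 * (P * M) × b ≡ 2 * (Q * N) × r ≡ P * Q + M * N × P * Q ≡ M * N + 1

conjugateFactorisation-cong : ∀ {a b r P M Q N P′ M′ Q′ N′} →
  P ≡ P′ → M ≡ M′ → Q ≡ Q′ → N ≡ N′ →
  ConjugateFactorisation a b r P M Q N → ConjugateFactorisation a b r P′ M′ Q′ N′
conjugateFactorisation-cong refl refl refl refl f = f

GcdFactorisation : (a b r : ℕ) → Set
GcdFactorisation a b r =
  ConjugateFactorisation a b r (plusPart a r) (minusPart a r) (plusPart b r) (minusPart b r)

halves-gcdFactorisation : ∀ x y k .{{_ : NonZero k}} → x * y ≡ suc k * k →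
  GcdFactorisation (x * 2) (y * 2) (suc (k * 2))
halves-gcdFactorisation x y k xy≡ =
  let x≡PM , y≡QN , PQ≡ , MN≡ = gcd-products-of-consecutive x y k xy≡ in
  conjugateFactorisation-cong
    (sym (plusPart-double x k)) (sym (minusPart-double x k))
    (sym (plusPart-double y k)) (sym (minusPart-double y k))
    (trans (*-comm x 2) (cong (2 *_) x≡PM) ,
     trans (*-comm y 2) (cong (2 *_) y≡QN) ,
     trans (odd k) (cong₂ _+_ (sym PQ≡) (sym MN≡)) ,
     trans PQ≡ (trans (+-comm 1 k) (cong (_+ 1) (sym MN≡))))
  where
  odd : ∀ k → suc (k * 2) ≡ suc k + k
  odd = solve-∀

extension-expansion : ∀ {a b r} P M Q N → ConjugateFactorisation a b r P M Q N →
  2 * ((N + P) * (Q + M)) ≡ a + b + 2 * r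
extension-expansion P M Q N (refl , refl , refl , _) = expand P M Q N
  where
  expand : ∀ P M Q N → 2 * ((N + P) * (Q + M)) ≡ 2 * (P * M) + 2 * (Q * N) + 2 * (P * Q + M * N)
  expand = solve-∀

extension-square : ∀ u v w {c} → c ≡ u + v + 2 * w → u * v + 1 ≡ w * w → u * c + 1 ≡ (u + w) * (u + w)
extension-square u v w refl uv+1≡w² = begin
  u * (u + v + 2 * w) + 1        ≡⟨ solve (u ∷ v ∷ w ∷ []) ⟩
  u * u + 2 * u * w + (u * v + 1) ≡⟨ cong (u * u + 2 * u * w +_) uv+1≡w² ⟩
  u * u + 2 * u * w + w * w       ≡⟨ solve (u ∷ w ∷ []) ⟩
  (u + w) * (u + w)               ∎
  where open ≡-Reasoning

extension-is-regular : ∀ {a b r} c → c ≡ a + b + 2 * r → a * b + 1 ≡ r * r →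
    (∃ λ s → a * c + 1 ≡ s * s)
  × (∃ λ t → b * c + 1 ≡ t * t)
  × (a * a + b * b + c * c ≡ 2 * (a * b) + 2 * (a * c) + 2 * (b * c) + 4)
extension-is-regular {a} {b} {r} c c≡ ab+1≡r² =
  (a + r , extension-square a b r c≡ ab+1≡r²) ,
  (b + r , extension-square b a r (trans c≡ (cong (_+ 2 * r) (+-comm a b)))
                            (trans (cong (_+ 1) (*-comm b a)) ab+1≡r²)) ,
  regular c≡
  where
  open ≡-Reasoning
  regular : c ≡ a + b + 2 * r → a * a + b * b + c * c ≡ 2 * (a * b) + 2 * (a * c) + 2 * (b * c) + 4
  regular refl = begin
    a * a + b * b + (a + b + 2 * r) * (a + b + 2 * r)
      ≡⟨ solve (a ∷ b ∷ r ∷ []) ⟩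
    2 * (a * a) + 2 * (b * b) + 2 * (a * b) + 4 * (a * r) + 4 * (b * r) + 4 * (r * r)
      ≡⟨ cong (λ z → 2 * (a * a) + 2 * (b * b) + 2 * (a * b) + 4 * (a * r) + 4 * (b * r) + 4 * z) (sym ab+1≡r²) ⟩
    2 * (a * a) + 2 * (b * b) + 2 * (a * b) + 4 * (a * r) + 4 * (b * r) + 4 * (a * b + 1)
      ≡⟨ solve (a ∷ b ∷ r ∷ []) ⟩
    2 * (a * b) + 2 * (a * (a + b + 2 * r)) + 2 * (b * (a + b + 2 * r)) + 4
      ∎

mainTheorem4 : (a b r : ℕ) → 0 < a → 0 < b → 0 < r → 2 ∣ a → 2 ∣ b → a * b + 1 ≡ r * r →
    (a ≡ 2 * (plusPart a r * minusPart a r))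
    × (b ≡ 2 * (plusPart b r * minusPart b r))
    × (r ≡ plusPart a r * plusPart b r + minusPart a r * minusPart b r)
    × (plusPart a r * plusPart b r ≡ minusPart a r * minusPart b r + 1)
    × (∃ λ s → a * thirdElem a b r + 1 ≡ s * s)
    × (∃ λ t → b * thirdElem a b r + 1 ≡ t * t)
    × (a * a + b * b + thirdElem a b r * thirdElem a b r
        ≡ 2 * (a * b) + 2 * (a * thirdElem a b r) + 2 * (b * thirdElem a b r) + 4)
mainTheorem4 .(x * 2) .(y * 2) r 0<a 0<b _ (divides-refl x) (divides-refl y) ab+1≡r²
  with odd-square-root {r = r} (∣m⇒∣m*n (y * 2) (n∣m*n x)) ab+1≡r²
... | k , refl =
  let a≡ , b≡ , r≡ , PQ≡MN+1 = factorisation in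
  a≡ , b≡ , r≡ , PQ≡MN+1 ,
  extension-is-regular {a} {b} {r} (thirdElem a b r)
    (extension-expansion (plusPart a r) (minusPart a r) (plusPart b r) (minusPart b r) factorisation)
    ab+1≡r²
  where
  a = x * 2
  b = y * 2
  xy≡ : x * y ≡ suc k * k
  xy≡ = halves-product x y k ab+1≡r²
  factorisation : GcdFactorisation a b r
  factorisation = halves-gcdFactorisation x y k {{halves-product-nonZero x y k 0<a 0<b xy≡}} xy≡
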